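{- Let $P=(P_{i,j})_{i,j\ge 0}$ be the array of integers defined by the initial values $P_{i,0}=-1$ for all $i\ge 0$, $P_{0,j}=0$ for all $j\ge 1$, and the recursion $P_{i,j}=2P_{i-1,j}-P_{i-1,j-1}$ for all $i\ge 1$, $j\ge 1$. For an integer $k\ge 2$, let $(F^{(k)}_n)_{n\in\mathbb{Z}}$ be the doubly infinite sequence determined by the initial values $F^{(k)}_i=0$ for $0\le i\le k-2$, $F^{(k)}_{k-1}=1$, and the recursion $F^{(k)}_n=\sum_{i=1}^{k}F^{(k)}_{n-i}$ for all integers $n$ (used forwards to define terms with index $\ge k$ and backwards to define terms with negative index). Then for every $k\ge 2$ and every integer $n$, $$F^{(k)}_n=\sum_{i=1}^{k}P_{k,i}\,F^{(k)}_{n-ki}.$$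
   Context: For example, the rows $i=2,3,4$ of $P$ (columns $j=1,\dots,i$) are $(3,-1)$, $(7,-5,1)$, $(15,-17,7,-1)$, giving $F_n=3F_{n-2}-F_{n-4}$ for the Fibonacci numbers ($k=2$), $F^{(3)}_n=7F^{(3)}_{n-3}-5F^{(3)}_{n-6}+F^{(3)}_{n-9}$ for the Tribonacci numbers, etc. -}

module Defs where

open import Data.Nat using (ℕ; zero; suc)
open import Data.Integer using (ℤ; +_; -_; _+_; _-_; _*_)

P : ℕ → ℕ → ℤ
P zero    zero    = - (+ 1)
P zero    (suc j) = + 0
P (suc i) zero    = - (+ 1)
P (suc i) (suc j) = (+ 2) * P i (suc j) - P i j

Σ₁ : ℕ → (ℕ → ℤ) → ℤ
Σ₁ zero    f = + 0
Σ₁ (suc k) f = Σ₁ k f + f (suc k)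

IsKBonacci : ℕ → (ℤ → ℤ) → Set
IsKBonacci k F =
  ((i : ℕ) → suc (suc i) Data.Nat.≤ k → F (+ i) ≡ + 0)
  × F (+ (k ∸ 1)) ≡ + 1
  × ((n : ℤ) → F n ≡ Σ₁ k (λ i → F (n - + i)))
  where
    open import Data.Nat using (_∸_)
    open import Data.Product using (_×_)
    open import Relation.Binary.PropositionalEquality using (_≡_)

-- Subtracting the recursion at n from the recursion at n + 1 gives the three-term
-- recurrence F(n+1) = 2F(n) − F(n−k).  Together with the row recursion of P it shows,
-- by induction on i, that
--   Σ_{j=1}^{i} P_{i,j} F(n − kj) = F(n) + (F(n) + ⋯ + F(n+i−1)) − F(n+i),
-- and at i = k the last two terms cancel, being the two sides of the recursion at n + k.
module Submission where

open import Defs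
open import Data.Nat using (ℕ; _≤_; _*_)
open import Data.Integer using (ℤ; +_; _-_) renaming (_*_ to _*ℤ_)
open import Relation.Binary.PropositionalEquality using (_≡_)

open import Data.Nat using (zero; suc; pred; _<_; s≤s)
import Data.Nat.Properties as ℕ
open import Data.Integer using (-_; _+_)
import Data.Integer.Properties as ℤ
open import Data.Integer.Tactic.RingSolver using (solve-∀)
open import Data.Product using (_,_)
open import Relation.Binary.PropositionalEquality using (refl; sym; trans; cong; cong₂; module ≡-Reasoning)
open ≡-Reasoning

Σ₁-cong : ∀ m {f g : ℕ → ℤ} → (∀ j → f (suc j) ≡ g (suc j)) → Σ₁ m f ≡ Σ₁ m g
Σ₁-cong zero    eq = refl
Σ₁-cong (suc m) eq = cong₂ _+_ (Σ₁-cong m eq) (eq m)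

Σ₁-distrib-sub : ∀ m (f g : ℕ → ℤ) → Σ₁ m (λ j → f j - g j) ≡ Σ₁ m f - Σ₁ m g
Σ₁-distrib-sub zero    f g = refl
Σ₁-distrib-sub (suc m) f g =
  trans (cong (_+ (f (suc m) - g (suc m))) (Σ₁-distrib-sub m f g))
        (interchange (Σ₁ m f) (Σ₁ m g) (f (suc m)) (g (suc m)))
  where
  interchange : ∀ a b c d → (a - b) + (c - d) ≡ (a + c) - (b + d)
  interchange = solve-∀

Σ₁-*-distribˡ : ∀ m c (f : ℕ → ℤ) → Σ₁ m (λ j → c *ℤ f j) ≡ c *ℤ Σ₁ m f
Σ₁-*-distribˡ zero    c f = sym (ℤ.*-zeroʳ c)
Σ₁-*-distribˡ (suc m) c f =
  trans (cong (_+ (c *ℤ f (suc m))) (Σ₁-*-distribˡ m c f))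
        (sym (ℤ.*-distribˡ-+ c (Σ₁ m f) (f (suc m))))

Σ₁-suc : ∀ m (f : ℕ → ℤ) → Σ₁ (suc m) f ≡ f 1 + Σ₁ m (λ j → f (suc j))
Σ₁-suc zero    f = ℤ.+-comm (+ 0) (f 1)
Σ₁-suc (suc m) f = trans (cong (_+ f (suc (suc m))) (Σ₁-suc m f)) (ℤ.+-assoc (f 1) _ _)

P-zeroʳ : ∀ i → P i 0 ≡ - + 1
P-zeroʳ zero    = refl
P-zeroʳ (suc i) = refl

P-above-diagonal : ∀ {i j} → i < j → P i j ≡ + 0
P-above-diagonal {zero}  {suc j} _ = refl
P-above-diagonal {suc i} {suc j} (s≤s i<j)
  rewrite P-above-diagonal {i} {suc j} (ℕ.m<n⇒m<1+n i<j) | P-above-diagonal i<j = refl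

Σ₁-P-suc : ∀ i (f : ℕ → ℤ) →
  Σ₁ (suc i) (λ j → P (suc i) j *ℤ f j) ≡
  + 2 *ℤ Σ₁ i (λ j → P i j *ℤ f j) - Σ₁ i (λ j → P i j *ℤ f (suc j)) + f 1
Σ₁-P-suc i f = begin
  Σ₁ (suc i) (λ j → P (suc i) j *ℤ f j)
    ≡⟨ Σ₁-cong (suc i) (λ j → distribʳ (P i (suc j)) (P i j) (f (suc j))) ⟩
  Σ₁ (suc i) (λ j → + 2 *ℤ (P i j *ℤ f j) - P i (pred j) *ℤ f j)
    ≡⟨ Σ₁-distrib-sub (suc i) _ _ ⟩
  Σ₁ (suc i) (λ j → + 2 *ℤ (P i j *ℤ f j)) - Σ₁ (suc i) (λ j → P i (pred j) *ℤ f j)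
    ≡⟨ cong₂ _-_ (Σ₁-*-distribˡ (suc i) (+ 2) _) (Σ₁-suc i _) ⟩
  + 2 *ℤ (Σ₁ i g + P i (suc i) *ℤ f (suc i)) - (P i 0 *ℤ f 1 + Σ₁ i g′)
    ≡⟨ cong₂ (λ p q → + 2 *ℤ (Σ₁ i g + p *ℤ f (suc i)) - (q *ℤ f 1 + Σ₁ i g′))
             (P-above-diagonal (ℕ.n<1+n i)) (P-zeroʳ i) ⟩
  + 2 *ℤ (Σ₁ i g + + 0 *ℤ f (suc i)) - (- + 1 *ℤ f 1 + Σ₁ i g′)
    ≡⟨ simplify (Σ₁ i g) (Σ₁ i g′) (f (suc i)) (f 1) ⟩
  + 2 *ℤ Σ₁ i g - Σ₁ i g′ + f 1 ∎
  where
  g g′ : ℕ → ℤ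
  g  j = P i j *ℤ f j
  g′ j = P i j *ℤ f (suc j)

  distribʳ : ∀ a b x → (+ 2 *ℤ a - b) *ℤ x ≡ + 2 *ℤ (a *ℤ x) - b *ℤ x
  distribʳ = solve-∀

  simplify : ∀ s s′ x y → + 2 *ℤ (s + + 0 *ℤ x) - (- + 1 *ℤ y + s′) ≡ + 2 *ℤ s - s′ + y
  simplify = solve-∀

Psum : ℕ → (ℤ → ℤ) → ℕ → ℤ → ℤ
Psum k F i n = Σ₁ i (λ j → P i j *ℤ F (n - + (k * j)))

window : (ℤ → ℤ) → ℕ → ℤ → ℤ
window F zero    n = + 0
window F (suc i) n = F n + window F i (n + + 1)

ShortRecurrence : ℕ → (ℤ → ℤ) → Set
ShortRecurrence k F = ∀ m → F (m + + 1) ≡ + 2 *ℤ F m - F (m - + k)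

Psum-suc : ∀ k F i n → Psum k F (suc i) n ≡ + 2 *ℤ Psum k F i n - Psum k F i (n - + k) + F (n - + k)
Psum-suc k F i n = begin
  Psum k F (suc i) n
    ≡⟨ Σ₁-P-suc i (λ j → F (n - + (k * j))) ⟩
  + 2 *ℤ Psum k F i n - Σ₁ i (λ j → P i j *ℤ F (n - + (k * suc j))) + F (n - + (k * 1))
    ≡⟨ cong₂ (λ s x → + 2 *ℤ Psum k F i n - s + F (n - + x))
             (Σ₁-cong i (λ j → cong (λ x → P i (suc j) *ℤ F x) (minus-k*suc (suc j))))
             (ℕ.*-identityʳ k) ⟩
  + 2 *ℤ Psum k F i n - Psum k F i (n - + k) + F (n - + k) ∎
  where
  minus-k*suc : ∀ j → n - + (k * suc j) ≡ n - + k - + (k * j)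
  minus-k*suc j = trans (cong (λ x → n - + x) (ℕ.*-suc k j))
                 (trans (cong (λ x → n - x) (ℤ.pos-+ k (k * j))) (sub-+ n (+ k) (+ (k * j))))
    where
    sub-+ : ∀ a b c → a - (b + c) ≡ a - b - c
    sub-+ = solve-∀

module _ (k : ℕ) (F : ℤ → ℤ) (step : ShortRecurrence k F) where

  window-short : ∀ i n → + 2 *ℤ window F i n - window F i (n - + k) ≡ window F i (n + + 1)
  window-short zero    n = refl
  window-short (suc i) n = begin
    + 2 *ℤ (F n + W (n + + 1)) - (F (n - + k) + W (n - + k + + 1))
      ≡⟨ regroup (F n) (W (n + + 1)) (F (n - + k)) (W (n - + k + + 1)) ⟩
    (+ 2 *ℤ F n - F (n - + k)) + (+ 2 *ℤ W (n + + 1) - W (n - + k + + 1))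
      ≡⟨ cong₂ _+_ (sym (step n)) (cong (λ x → + 2 *ℤ W (n + + 1) - W x) (sub-add-comm n (+ k) (+ 1))) ⟩
    F (n + + 1) + (+ 2 *ℤ W (n + + 1) - W (n + + 1 - + k))
      ≡⟨ cong (λ x → F (n + + 1) + x) (window-short i (n + + 1)) ⟩
    F (n + + 1) + W (n + + 1 + + 1) ∎
    where
    W : ℤ → ℤ
    W = window F i

    regroup : ∀ a b c d → + 2 *ℤ (a + b) - (c + d) ≡ (+ 2 *ℤ a - c) + (+ 2 *ℤ b - d)
    regroup = solve-∀

    sub-add-comm : ∀ a b c → a - b + c ≡ a + c - b
    sub-add-comm = solve-∀

  Psum-closed : ∀ i n → Psum k F i n ≡ F n + window F i n - F (n + + i)
  Psum-closed zero n =
    trans (cancel (F n)) (cong (λ x → F n + + 0 - F x) (sym (ℤ.+-identityʳ n)))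
    where
    cancel : ∀ a → + 0 ≡ a + + 0 - a
    cancel = solve-∀
  Psum-closed (suc i) n = begin
    Psum k F (suc i) n
      ≡⟨ Psum-suc k F i n ⟩
    + 2 *ℤ Psum k F i n - Psum k F i (n - + k) + F (n - + k)
      ≡⟨ cong₂ (λ a b → + 2 *ℤ a - b + F (n - + k)) (Psum-closed i n) (Psum-closed i (n - + k)) ⟩
    + 2 *ℤ (F n + W n - F (n + + i)) - (F (n - + k) + W (n - + k) - F (n - + k + + i)) + F (n - + k)
      ≡⟨ cong (λ x → + 2 *ℤ (F n + W n - F (n + + i)) - (F (n - + k) + W (n - + k) - F x) + F (n - + k))
              (sub-add-comm n (+ k) (+ i)) ⟩
    + 2 *ℤ (F n + W n - F (n + + i)) - (F (n - + k) + W (n - + k) - F (n + + i - + k)) + F (n - + k)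
      ≡⟨ regroup (F n) (W n) (W (n - + k)) (F (n + + i)) (F (n + + i - + k)) (F (n - + k)) ⟩
    F n + (F n + (+ 2 *ℤ W n - W (n - + k))) - (+ 2 *ℤ F (n + + i) - F (n + + i - + k))
      ≡⟨ cong₂ (λ a b → F n + (F n + a) - b) (window-short i n) (sym (step (n + + i))) ⟩
    F n + (F n + W (n + + 1)) - F (n + + i + + 1)
      ≡⟨ cong (λ x → F n + (F n + W (n + + 1)) - F x) (add-suc n i) ⟩
    F n + window F (suc i) n - F (n + + suc i) ∎
    where
    W : ℤ → ℤ
    W = window F i

    sub-add-comm : ∀ a b c → a - b + c ≡ a + c - b
    sub-add-comm = solve-∀

    regroup : ∀ a w w′ x y z →
      + 2 *ℤ (a + w - x) - (z + w′ - y) + z ≡ a + (a + (+ 2 *ℤ w - w′)) - (+ 2 *ℤ x - y)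
    regroup = solve-∀

    add-suc : ∀ n i → n + + i + + 1 ≡ n + + suc i
    add-suc n i = trans (ℤ.+-assoc n (+ i) (+ 1))
                        (cong (λ x → n + x) (trans (sym (ℤ.pos-+ i 1)) (cong +_ (ℕ.+-comm i 1))))

Σ₁-backwards-window : ∀ (F : ℤ → ℤ) m c → Σ₁ m (λ i → F (c - + i)) ≡ window F m (c - + m)
Σ₁-backwards-window F zero    c = refl
Σ₁-backwards-window F (suc m) c = begin
  Σ₁ m (λ i → F (c - + i)) + F (c - + suc m)
    ≡⟨ cong (_+ F (c - + suc m)) (Σ₁-backwards-window F m c) ⟩
  window F m (c - + m) + F (c - + suc m)
    ≡⟨ ℤ.+-comm (window F m (c - + m)) _ ⟩
  F (c - + suc m) + window F m (c - + m)
    ≡⟨ cong (λ x → F (c - + suc m) + window F m x) (sym sub-suc-add-one) ⟩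
  F (c - + suc m) + window F m (c - + suc m + + 1) ∎
  where
  sub-suc-add-one : c - + suc m + + 1 ≡ c - + m
  sub-suc-add-one = trans (cong (λ x → c - x + + 1) (ℤ.pos-+ 1 m)) (ring c (+ m))
    where
    ring : ∀ a b → a - (+ 1 + b) + + 1 ≡ a - b
    ring = solve-∀

module _ (k : ℕ) (F : ℤ → ℤ) (rec : ∀ n → F n ≡ Σ₁ (suc k) (λ i → F (n - + i))) where

  kbonacci-short : ShortRecurrence (suc k) F
  kbonacci-short m = begin
    F (m + + 1)
      ≡⟨ rec (m + + 1) ⟩
    Σ₁ (suc k) (λ i → F (m + + 1 - + i))
      ≡⟨ Σ₁-suc k _ ⟩
    F (m + + 1 - + 1) + Σ₁ k (λ j → F (m + + 1 - + suc j))
      ≡⟨ cong₂ _+_ (cong F (add-sub m)) (Σ₁-cong k (λ j → cong F (add-sub-suc (suc j)))) ⟩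
    F m + Σ₁ k (λ j → F (m - + j))
      ≡⟨ double (F m) _ _ (rec m) ⟩
    + 2 *ℤ F m - F (m - + suc k) ∎
    where
    add-sub : ∀ a → a + + 1 - + 1 ≡ a
    add-sub = solve-∀

    add-sub-suc : ∀ j → m + + 1 - + suc j ≡ m - + j
    add-sub-suc j = trans (cong (λ x → m + + 1 - x) (ℤ.pos-+ 1 j)) (ring m (+ j))
      where
      ring : ∀ a b → a + + 1 - (+ 1 + b) ≡ a - b
      ring = solve-∀

    double : ∀ a b c → a ≡ b + c → a + b ≡ + 2 *ℤ a - c
    double _ b c refl = ring b c
      where
      ring : ∀ b c → (b + c) + b ≡ + 2 *ℤ (b + c) - c
      ring = solve-∀

  kbonacci-window : ∀ n → F (n + + suc k) ≡ window F (suc k) n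
  kbonacci-window n =
    trans (rec (n + + suc k))
          (trans (Σ₁-backwards-window F (suc k) (n + + suc k)) (cong (window F (suc k)) (add-sub n (+ suc k))))
    where
    add-sub : ∀ a b → a + b - b ≡ a
    add-sub = solve-∀

theorem1p3 : (k : ℕ) → 2 ≤ k → (F : ℤ → ℤ) → IsKBonacci k F →
    (n : ℤ) → F n ≡ Σ₁ k (λ i → P k i *ℤ F (n - + (k * i)))
theorem1p3 (suc k) _ F (_ , _ , rec) n = sym (begin
  Psum (suc k) F (suc k) n                       ≡⟨ Psum-closed (suc k) F (kbonacci-short k F rec) (suc k) n ⟩
  F n + window F (suc k) n - F (n + + suc k)     ≡⟨ cong (λ x → F n + window F (suc k) n - x) (kbonacci-window k F rec n) ⟩
  F n + window F (suc k) n - window F (suc k) n  ≡⟨ cancel (F n) (window F (suc k) n) ⟩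
  F n ∎)
  where
  cancel : ∀ a b → a + b - b ≡ a
  cancel = solve-∀
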